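{- Let $q \ge 1$ be an integer and $H$ a graph. If $H$ is not $q$-Ramsey simple, then $H$ is not $(q+1)$-Ramsey simple.
   Context: A graph $G$ is $q$-Ramsey for $H$ if every $q$-colouring of $E(G)$ contains a monochromatic copy of $H$; it is minimal $q$-Ramsey for $H$ if it is $q$-Ramsey for $H$ and no proper subgraph is. $s_q(H)$ denotes the minimum of $\delta(G)$ over all minimal $q$-Ramsey graphs $G$ for $H$. One always has $s_q(H) \ge q(\delta(H)-1)+1$. A graph $H$ without isolated vertices is $q$-Ramsey simple if $s_q(H)=q(\delta(H)-1)+1$; a graph with isolated vertices is $q$-Ramsey simple if the graph obtained by deleting its isolated vertices is. -}

module Defs where

open import Data.Nat using (ℕ; zero; suc; _+_; _*_; _∸_; _⊓_; _≤_; _<_)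
open import Data.Fin using (Fin; zero; suc)
open import Data.Bool using (Bool; true; false; if_then_else_)
open import Data.List using (List; map; allFin)
open import Data.Nat.ListAction using (sum)
open import Data.Empty using (⊥)
open import Data.Product using (Σ; _×_; ∃; ∃-syntax; _,_)
open import Data.Sum using (_⊎_)
open import Relation.Binary.PropositionalEquality using (_≡_; _≢_)
open import Function.Definitions using (Injective)

record Graph : Set where
  field
    n     : ℕ
    adj   : Fin n → Fin n → Bool
    sym   : ∀ u v → adj u v ≡ adj v u
    irrefl : ∀ v → adj v v ≡ false
open Graph public

-- degree and minimum degree (convention: δ of the graph with 0 vertices is 0)
deg : (G : Graph) → Fin (n G) → ℕ
deg G v = sum (map (λ w → if adj G v w then 1 else 0) (allFin (n G)))

minOver : (m : ℕ) → (Fin m → ℕ) → ℕ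
minOver zero f = 0
minOver (suc zero) f = f zero
minOver (suc (suc m)) f = f zero ⊓ minOver (suc m) (λ i → f (suc i))

δ : Graph → ℕ
δ G = minOver (n G) (deg G)

record Embedding (H G : Graph) : Set where
  field
    f   : Fin (n H) → Fin (n G)
    inj : Injective _≡_ _≡_ f
    hom : ∀ u v → adj H u v ≡ true → adj G (f u) (f v) ≡ true
open Embedding public

ProperSubgraph : Graph → Graph → Set
ProperSubgraph G' G = Σ (Embedding G' G) λ e →
    (∃[ w ] (∀ u → f e u ≢ w))
  ⊎ (∃[ u ] ∃[ v ] (adj G (f e u) (f e v) ≡ true × adj G' u v ≡ false))

-- q-colourings of the edges of G (values on non-edges are irrelevant)
record Colouring (q : ℕ) (G : Graph) : Set where
  field
    col    : Fin (n G) → Fin (n G) → Fin q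
    colSym : ∀ u v → col u v ≡ col v u
open Colouring public

MonoCopy : {q : ℕ} (H G : Graph) → Colouring q G → Set
MonoCopy {q} H G c = Σ (Embedding H G) λ e → ∃[ i ]
  (∀ u v → adj H u v ≡ true → col c (f e u) (f e v) ≡ i)

IsRamsey : ℕ → Graph → Graph → Set
IsRamsey q G H = (c : Colouring q G) → MonoCopy H G c

IsMinimalRamsey : ℕ → Graph → Graph → Set
IsMinimalRamsey q G H =
  IsRamsey q G H × (∀ G' → ProperSubgraph G' G → IsRamsey q G' H → ⊥)

SqIs : ℕ → Graph → ℕ → Set
SqIs q H k =
  (∃[ G ] (IsMinimalRamsey q G H × δ G ≡ k))
  × (∀ G → IsMinimalRamsey q G H → k ≤ δ G)

Isolated : (H : Graph) → Fin (n H) → Set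
Isolated H v = ∀ w → adj H v w ≡ false

NoIsolated : Graph → Set
NoIsolated H = ∀ v → ∃[ w ] (adj H v w ≡ true)

-- H' is obtained from H by deleting its isolated vertices:
-- H' is (isomorphic to) the induced subgraph on the non-isolated vertices.
DeleteIsolated : Graph → Graph → Set
DeleteIsolated H H' = Σ (Fin (n H') → Fin (n H)) λ g →
    Injective _≡_ _≡_ g
  × (∀ u v → adj H' u v ≡ adj H (g u) (g v))
  × (∀ w → (∃[ x ] (adj H w x ≡ true)) → ∃[ u ] (g u ≡ w))
  × NoIsolated H'

RamseySimple₀ : ℕ → Graph → Set
RamseySimple₀ q H = SqIs q H (q * (δ H ∸ 1) + 1)

RamseySimple : ℕ → Graph → Set
RamseySimple q H = Σ Graph λ H' → DeleteIsolated H H' × RamseySimple₀ q H'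

{-# OPTIONS --safe #-}
-- Write d = δ(H) − 1, let G be a minimal (q+1)-Ramsey graph for H with a vertex v of degree
-- (q+1)d + 1, and c a (q+1)-colouring of G − v without monochromatic H (minimality gives one;
-- constructively, we refute its existence for each c and use that having a monochromatic copy
-- is decidable). Give the edges from v to its first d neighbours colour 0, and delete from G
-- every edge of colour 0; call the result G″. It is q-Ramsey: a q-colouring of G″, shifted up
-- by one and completed by colour 0 on the deleted edges, colours G, and a copy of H in colour 0
-- can neither avoid v (c has none) nor use v (only d edges at v have colour 0, while every
-- vertex of H has degree > d). A q-Ramsey subgraph of G″ must contain v, as otherwise c, shifted
-- down, would colour it without a monochromatic H; and v has degree qd + 1 in G″. So a minimal
-- q-Ramsey subgraph of G″ meets the general lower bound s_q(H) ≥ qd + 1.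

module Submission where

open import Defs hiding (sym)
open import Data.Bool using (Bool; true; false; if_then_else_; _∧_)
open import Data.Bool.Properties using () renaming (_≟_ to _≟ᵇ_)
open import Data.Empty using (⊥; ⊥-elim)
open import Data.Fin using (Fin; zero; suc; punchIn; punchOut; toℕ; fromℕ<; combine; remQuot)
open import Data.Fin.Properties
  using (suc-injective; punchIn-injective; punchInᵢ≢i; punchIn-punchOut; fromℕ<-injective; toℕ-fromℕ<;
         combine-injective; combine-remQuot; remQuot-combine; any?; all?)
  renaming (_≟_ to _≟ᶠ_)
open import Data.List using (map; tabulate)
open import Data.Nat using (ℕ; zero; suc; NonZero; _+_; _*_; _∸_; _≤_; _<_; z≤n; s≤s; _≤?_; _<?_)
open import Data.Nat.DivMod using (_mod_; _/_; _%_; m<n*o⇒m/o<n; m≡m%n+[m/n]*n)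
open import Data.Nat.ListAction using (sum)
open import Data.Nat.Properties hiding (suc-injective; _≟_)
open import Data.Product using (Σ; _×_; ∃; ∃-syntax; _,_; proj₁; proj₂)
open import Data.Sum using (_⊎_; inj₁; inj₂)
open import Data.Vec.Functional using (_∷_)
open import Function using (_∘_; case_of_)
open import Function.Definitions using (Injective)
open import Induction.WellFounded using (Acc; acc)
open import Data.Nat.Induction using (<-wellFounded)
open import Relation.Binary.PropositionalEquality
open import Relation.Nullary using (¬_; Dec; yes; no; does)
open import Relation.Nullary.Decidable using (_×-dec_; _→-dec_; map′; dec-true; dec-false)

∧-true⁻ : ∀ {a b} → a ∧ b ≡ true → a ≡ true × b ≡ true
∧-true⁻ {true} b≡true = refl , b≡true

does-true : ∀ {A : Set} (a? : Dec A) → does a? ≡ true → A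
does-true (yes a) _ = a

does-false : ∀ {A : Set} (a? : Dec A) → does a? ≡ false → ¬ A
does-false (no ¬a) _ = ¬a

indicator : Bool → ℕ
indicator b = if b then 1 else 0

count : ∀ {m} → (Fin m → Bool) → ℕ
count {zero}  P = 0
count {suc m} P = indicator (P zero) + count (P ∘ suc)

InjectiveOn : ∀ {m} {A : Set} (P : Fin m → Bool) → (∀ i → P i ≡ true → A) → Set
InjectiveOn P φ = ∀ {i j} p q → φ i p ≡ φ j q → i ≡ j

_except_ : ∀ {m} → (Fin m → Bool) → Fin m → Fin m → Bool
(Q except j) i = if does (i ≟ᶠ j) then false else Q i

count-except : ∀ {m} (Q : Fin m → Bool) j → Q j ≡ true → count Q ≡ suc (count (Q except j))
count-except {suc m} Q zero    Qj rewrite Qj = refl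
count-except {suc m} Q (suc j) Qj =
  trans (cong (indicator (Q zero) +_) (count-except (Q ∘ suc) j Qj)) (+-suc _ _)

except-true : ∀ {m} (Q : Fin m → Bool) {i j} → Q i ≡ true → i ≢ j → (Q except j) i ≡ true
except-true Q {i} {j} Qi i≢j rewrite dec-false (i ≟ᶠ j) i≢j = Qi

count-mono : ∀ {m k} (P : Fin m → Bool) (Q : Fin k → Bool) (φ : ∀ i → P i ≡ true → Fin k) →
  (∀ i p → Q (φ i p) ≡ true) → InjectiveOn P φ → count P ≤ count Q
count-mono {zero}  P Q φ into inj = z≤n
count-mono {suc m} {k} P Q φ into inj with P zero in P0
... | false = count-mono (P ∘ suc) Q (φ ∘ suc) (into ∘ suc) inj′
  where
  inj′ : InjectiveOn (P ∘ suc) (φ ∘ suc)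
  inj′ p q eq = suc-injective (inj p q eq)
... | true = begin
  suc (count (P ∘ suc))   ≤⟨ s≤s (count-mono (P ∘ suc) (Q except j) (φ ∘ suc) into′ inj′) ⟩
  suc (count (Q except j)) ≡⟨ count-except Q j (into zero P0) ⟨
  count Q                 ∎
  where
  open ≤-Reasoning
  j : Fin k
  j = φ zero P0
  inj′ : InjectiveOn (P ∘ suc) (φ ∘ suc)
  inj′ p q eq = suc-injective (inj p q eq)
  into′ : ∀ i p → (Q except j) (φ (suc i) p) ≡ true
  into′ i p = except-true Q (into (suc i) p) (λ eq → 0≢suc (inj P0 p (sym eq)))
    where
    0≢suc : ∀ {m} {i : Fin m} → zero ≢ suc i
    0≢suc ()

count-mono-< : ∀ {m k} (P : Fin m → Bool) (Q : Fin k → Bool) (φ : ∀ i → P i ≡ true → Fin k) →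
  (∀ i p → Q (φ i p) ≡ true) → InjectiveOn P φ →
  ∀ j → Q j ≡ true → (∀ i p → φ i p ≢ j) → count P < count Q
count-mono-< P Q φ into inj j Qj missed = begin-strict
  count P                 <⟨ s≤s (count-mono P (Q except j) φ into′ inj) ⟩
  suc (count (Q except j)) ≡⟨ count-except Q j Qj ⟨
  count Q                 ∎
  where
  open ≤-Reasoning
  into′ : ∀ i p → (Q except j) (φ i p) ≡ true
  into′ i p = except-true Q (into i p) (missed i p)

count-true : ∀ m → count {m} (λ _ → true) ≡ m
count-true zero    = refl
count-true (suc m) = cong suc (count-true m)

count-≤-bounded : ∀ {m} d (P : Fin m → Bool) (φ : Fin m → ℕ) →
  (∀ i → P i ≡ true → φ i < d) → InjectiveOn P (λ i _ → φ i) → count P ≤ d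
count-≤-bounded d P φ bounded inj = begin
  count P               ≤⟨ count-mono P (λ _ → true) φ′ (λ _ _ → refl) inj′ ⟩
  count {d} (λ _ → true) ≡⟨ count-true d ⟩
  d                     ∎
  where
  open ≤-Reasoning
  φ′ : ∀ i → P i ≡ true → Fin d
  φ′ i p = fromℕ< (bounded i p)
  inj′ : InjectiveOn P φ′
  inj′ p q eq = inj p q (fromℕ<-injective _ _ (bounded _ p) (bounded _ q) eq)

rank : ∀ {m} → (Fin m → Bool) → Fin m → ℕ
rank P zero    = 0
rank P (suc i) = indicator (P zero) + rank (P ∘ suc) i

rank<count : ∀ {m} (P : Fin m → Bool) i → P i ≡ true → rank P i < count P
rank<count P zero    Pi rewrite Pi = s≤s z≤n
rank<count P (suc i) Pi = +-monoʳ-< (indicator (P zero)) (rank<count (P ∘ suc) i Pi)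

rank-injective : ∀ {m} (P : Fin m → Bool) → InjectiveOn P (λ i _ → rank P i)
rank-injective P {zero}  {zero}  p q eq = refl
rank-injective P {zero}  {suc j} p q eq rewrite p = ⊥-elim (0≢1+n eq)
rank-injective P {suc i} {zero}  p q eq rewrite q = ⊥-elim (0≢1+n (sym eq))
rank-injective P {suc i} {suc j} p q eq =
  cong suc (rank-injective (P ∘ suc) p q (+-cancelˡ-≡ (indicator (P zero)) _ _ eq))

count-rank-< : ∀ {m} (P : Fin m → Bool) d → count (λ i → P i ∧ does (rank P i <? d)) ≤ d
count-rank-< P d = count-≤-bounded d _ (rank P) bounded
  (λ p q → rank-injective P (proj₁ (∧-true⁻ p)) (proj₁ (∧-true⁻ q)))
  where
  bounded : ∀ i → (P i ∧ does (rank P i <? d)) ≡ true → rank P i < d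
  bounded i p = does-true (rank P i <? d) (proj₂ (∧-true⁻ {P i} p))

count-rank-≥ : ∀ {m} (P : Fin m → Bool) d → count (λ i → P i ∧ does (d ≤? rank P i)) ≤ count P ∸ d
count-rank-≥ P d = count-≤-bounded (count P ∸ d) _ (λ i → rank P i ∸ d) bounded injective
  where
  d≤rank : ∀ {i} → (P i ∧ does (d ≤? rank P i)) ≡ true → d ≤ rank P i
  d≤rank {i} p = does-true (d ≤? rank P i) (proj₂ (∧-true⁻ {P i} p))
  bounded : ∀ i → (P i ∧ does (d ≤? rank P i)) ≡ true → rank P i ∸ d < count P ∸ d
  bounded i p = ∸-monoˡ-< (rank<count P i (proj₁ (∧-true⁻ p))) (d≤rank p)
  injective : InjectiveOn _ (λ i _ → rank P i ∸ d)
  injective p q eq = rank-injective P (proj₁ (∧-true⁻ p)) (proj₁ (∧-true⁻ q))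
    (∸-cancelʳ-≡ (d≤rank p) (d≤rank q) eq)

count-rank-mod : ∀ {m} (P : Fin m → Bool) q d .{{_ : NonZero q}} → count P ≤ q * d →
  ∀ i → count (λ w → P w ∧ does ((rank P w mod q) ≟ᶠ i)) ≤ d
count-rank-mod P q d countP≤ i = count-≤-bounded d _ (λ w → rank P w / q) bounded injective
  where
  bounded : ∀ w → (P w ∧ does ((rank P w mod q) ≟ᶠ i)) ≡ true → rank P w / q < d
  bounded w p = m<n*o⇒m/o<n
    (<-≤-trans (rank<count P w (proj₁ (∧-true⁻ p))) (≤-trans countP≤ (≤-reflexive (*-comm q d))))
  residue : ∀ {w} → (P w ∧ does ((rank P w mod q) ≟ᶠ i)) ≡ true → rank P w % q ≡ toℕ i
  residue {w} p = trans (sym (toℕ-fromℕ< _))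
    (cong toℕ (does-true ((rank P w mod q) ≟ᶠ i) (proj₂ (∧-true⁻ {P w} p))))
  injective : InjectiveOn _ (λ w _ → rank P w / q)
  injective {w} {w′} p p′ eq = rank-injective P (proj₁ (∧-true⁻ p)) (proj₁ (∧-true⁻ p′)) (begin
    rank P w                         ≡⟨ m≡m%n+[m/n]*n (rank P w) q ⟩
    rank P w % q + rank P w / q * q   ≡⟨ cong₂ (λ r s → r + s * q) (trans (residue p) (sym (residue p′))) eq ⟩
    rank P w′ % q + rank P w′ / q * q ≡⟨ m≡m%n+[m/n]*n (rank P w′) q ⟨
    rank P w′                        ∎)
    where open ≡-Reasoning

deg≡count : (G : Graph) (v : Fin (n G)) → deg G v ≡ count (adj G v)
deg≡count G v = sum-tabulate (adj G v) (λ w → w)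
  where
  sum-tabulate : ∀ {m k} (P : Fin k → Bool) (g : Fin m → Fin k) →
    sum (map (indicator ∘ P) (tabulate g)) ≡ count (P ∘ g)
  sum-tabulate {zero}  P g = refl
  sum-tabulate {suc m} P g = cong (indicator (P (g zero)) +_) (sum-tabulate P (g ∘ suc))

minOver-≤ : ∀ m (g : Fin m → ℕ) i → minOver m g ≤ g i
minOver-≤ (suc zero)    g zero    = ≤-refl
minOver-≤ (suc (suc m)) g zero    = m⊓n≤m _ _
minOver-≤ (suc (suc m)) g (suc i) = ≤-trans (m⊓n≤n _ _) (minOver-≤ (suc m) (g ∘ suc) i)

minOver-attained : ∀ m (g : Fin (suc m) → ℕ) → ∃[ i ] minOver (suc m) g ≡ g i
minOver-attained zero    g = zero , refl
minOver-attained (suc m) g with ⊓-sel (g zero) (minOver (suc m) (g ∘ suc))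
... | inj₁ eq = zero , eq
... | inj₂ eq = let i , eq′ = minOver-attained m (g ∘ suc) in suc i , trans eq eq′

δ≤deg : (G : Graph) (v : Fin (n G)) → δ G ≤ deg G v
δ≤deg G v = minOver-≤ (n G) (deg G) v

δ-attained : (G : Graph) → Fin (n G) → ∃[ v ] δ G ≡ deg G v
δ-attained G@record { n = suc m } _ = minOver-attained m (deg G)

vertex? : (G : Graph) → Fin (n G) ⊎ ¬ Fin (n G)
vertex? record { n = zero }  = inj₂ λ ()
vertex? record { n = suc m } = inj₁ zero

vertex-of-δ>0 : (H : Graph) → 0 < δ H → Fin (n H)
vertex-of-δ>0 record { n = suc m } _ = zero

δ-noIsolated : (H : Graph) → NoIsolated H → Fin (n H) → δ H ≡ suc (δ H ∸ 1)
δ-noIsolated H noIsolated u with δ-attained H u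
... | v , δ≡deg with noIsolated v
... | w , vw rewrite δ≡deg | deg≡count H v | count-except (adj H v) w vw = refl

idᴱ : (G : Graph) → Embedding G G
idᴱ G = record { f = λ x → x ; inj = λ eq → eq ; hom = λ _ _ e → e }

_∘ᴱ_ : ∀ {A B C} → Embedding B C → Embedding A B → Embedding A C
e ∘ᴱ e′ = record
  { f   = f e ∘ f e′
  ; inj = inj e′ ∘ inj e
  ; hom = λ u w uw → hom e _ _ (hom e′ u w uw)
  }

deg≤count-neighbours : ∀ {H G} (e : Embedding H G) {u v} → f e u ≡ v → (R : Fin (n G) → Bool) →
  (∀ w → adj H u w ≡ true → R (f e w) ≡ true) → deg H u ≤ count (λ w → adj G v w ∧ R w)
deg≤count-neighbours {H} {G} e {u} refl R into = begin
  deg H u         ≡⟨ deg≡count H u ⟩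
  count (adj H u) ≤⟨ count-mono (adj H u) _ (λ w _ → f e w) into′ (λ _ _ → inj e) ⟩
  count (λ w → adj G (f e u) w ∧ R w) ∎
  where
  open ≤-Reasoning
  into′ : ∀ w → adj H u w ≡ true → (adj G (f e u) (f e w) ∧ R (f e w)) ≡ true
  into′ w uw = cong₂ _∧_ (hom e u w uw) (into w uw)

_─_ : (G : Graph) → Fin (n G) → Graph
record { n = suc m ; adj = a ; sym = s ; irrefl = i } ─ v = record
  { n      = m
  ; adj    = λ x y → a (punchIn v x) (punchIn v y)
  ; sym    = λ x y → s _ _
  ; irrefl = λ x → i _
  }

ι : (G : Graph) (v : Fin (n G)) → Fin (n (G ─ v)) → Fin (n G)
ι record { n = suc m } v = punchIn v

ι-injective : (G : Graph) (v : Fin (n G)) → Injective _≡_ _≡_ (ι G v)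
ι-injective record { n = suc m } v = punchIn-injective v _ _

ι≢ : (G : Graph) (v : Fin (n G)) → ∀ x → ι G v x ≢ v
ι≢ record { n = suc m } v = punchInᵢ≢i v

ι-adj : (G : Graph) (v : Fin (n G)) → ∀ x y → adj (G ─ v) x y ≡ adj G (ι G v x) (ι G v y)
ι-adj record { n = suc m } v x y = refl

preimage : (G : Graph) (v : Fin (n G)) {w : Fin (n G)} → w ≢ v → Fin (n (G ─ v))
preimage record { n = suc m } v w≢v = punchOut (w≢v ∘ sym)

ι-preimage : (G : Graph) (v : Fin (n G)) {w : Fin (n G)} (w≢v : w ≢ v) → ι G v (preimage G v w≢v) ≡ w
ι-preimage record { n = suc m } v w≢v = punchIn-punchOut (w≢v ∘ sym)

preimage-ι : (G : Graph) (v : Fin (n G)) → ∀ x (ιx≢v : ι G v x ≢ v) → preimage G v ιx≢v ≡ x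
preimage-ι G v x ιx≢v = ι-injective G v (ι-preimage G v ιx≢v)

─-embedding : (G : Graph) (v : Fin (n G)) → Embedding (G ─ v) G
─-embedding G v = record
  { f   = ι G v
  ; inj = ι-injective G v
  ; hom = λ x y xy → trans (sym (ι-adj G v x y)) xy
  }

─-proper : (G : Graph) (v : Fin (n G)) → ProperSubgraph (G ─ v) G
─-proper G v = ─-embedding G v , inj₁ (v , ι≢ G v)

module _ {H : Graph} (G : Graph) (v : Fin (n G)) (e : Embedding H G) (avoids : ∀ u → f e u ≢ v) where

  restrict : Embedding H (G ─ v)
  restrict = record
    { f   = λ u → preimage G v (avoids u)
    ; inj = λ {a} {b} eq → inj e (begin
        f e a                            ≡⟨ ι-preimage G v (avoids a) ⟨
        ι G v (preimage G v (avoids a))  ≡⟨ cong (ι G v) eq ⟩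
        ι G v (preimage G v (avoids b))  ≡⟨ ι-preimage G v (avoids b) ⟩
        f e b                            ∎)
    ; hom = λ a b ab → begin
        adj (G ─ v) (preimage G v (avoids a)) (preimage G v (avoids b))          ≡⟨ ι-adj G v _ _ ⟩
        adj G (ι G v (preimage G v (avoids a))) (ι G v (preimage G v (avoids b)))
          ≡⟨ cong₂ (adj G) (ι-preimage G v (avoids a)) (ι-preimage G v (avoids b)) ⟩
        adj G (f e a) (f e b)                                                    ≡⟨ hom e a b ab ⟩
        true                                                                     ∎
    }
    where open ≡-Reasoning

  ι-restrict : ∀ u → ι G v (f restrict u) ≡ f e u
  ι-restrict u = ι-preimage G v (avoids u)

module _ {k} (G : Graph) (v : Fin (n G)) (c : Colouring k (G ─ v)) (σ : Fin (n G) → Fin k) where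

  extendCol : Fin (n G) → Fin (n G) → Fin k
  extendCol x y with x ≟ᶠ v | y ≟ᶠ v
  ... | yes _   | _       = σ y
  ... | no  _   | yes _   = σ x
  ... | no  x≢v | no  y≢v = col c (preimage G v x≢v) (preimage G v y≢v)

  extendCol-sym : ∀ x y → extendCol x y ≡ extendCol y x
  extendCol-sym x y with x ≟ᶠ v | y ≟ᶠ v
  ... | yes refl | yes refl = refl
  ... | yes refl | no  _    = refl
  ... | no  _    | yes refl = refl
  ... | no  _    | no  _    = colSym c _ _

  extend : Colouring k G
  extend = record { col = extendCol ; colSym = extendCol-sym }

  extend-at : ∀ w → col extend v w ≡ σ w
  extend-at w with v ≟ᶠ v
  ... | yes _   = refl
  ... | no  v≢v = ⊥-elim (v≢v refl)

  extend-ι : ∀ x y → col extend (ι G v x) (ι G v y) ≡ col c x y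
  extend-ι x y with ι G v x ≟ᶠ v | ι G v y ≟ᶠ v
  ... | yes ιx≡v | _        = ⊥-elim (ι≢ G v x ιx≡v)
  ... | no  _    | yes ιy≡v = ⊥-elim (ι≢ G v y ιy≡v)
  ... | no  ιx≢v | no  ιy≢v = cong₂ (col c) (preimage-ι G v x ιx≢v) (preimage-ι G v y ιy≢v)

  extend-restrict : ∀ {H} (e : Embedding H G) (avoids : ∀ u → f e u ≢ v) a b →
    col c (f (restrict G v e avoids) a) (f (restrict G v e avoids) b) ≡ col extend (f e a) (f e b)
  extend-restrict e avoids a b =
    trans (sym (extend-ι _ _)) (cong₂ extendCol (ι-restrict G v e avoids a) (ι-restrict G v e avoids b))

any-function? : ∀ a {b} (P : (Fin a → Fin b) → Set) → (∀ {g h} → (∀ x → g x ≡ h x) → P g → P h) →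
  (∀ g → Dec (P g)) → Dec (∃ P)
any-function? zero P resp P? = map′ (_ ,_) (λ (g , Pg) → resp (λ ()) Pg) (P? (λ ()))
any-function? (suc a) P resp P? =
  map′ (λ (x , g , Pxg) → x ∷ g , Pxg)
       (λ (g , Pg) → g zero , g ∘ suc , resp (λ { zero → refl ; (suc x) → refl }) Pg)
       (any? λ x → any-function? a (P ∘ (x ∷_)) (λ eq → resp λ { zero → refl ; (suc y) → eq y })
                                  (P? ∘ (x ∷_)))

module _ {q} (H G : Graph) (c : Colouring q G) where

  IsMonoCopy : (Fin (n H) → Fin (n G)) → Set
  IsMonoCopy g = ( (∀ x y → g x ≡ g y → x ≡ y)
                 × (∀ u w → adj H u w ≡ true → adj G (g u) (g w) ≡ true))
               × ∃[ i ] (∀ u w → adj H u w ≡ true → col c (g u) (g w) ≡ i)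

  IsMonoCopy? : ∀ g → Dec (IsMonoCopy g)
  IsMonoCopy? g =
    ((all? λ x → all? λ y → (g x ≟ᶠ g y) →-dec (x ≟ᶠ y)) ×-dec
     (all? λ u → all? λ w → (adj H u w ≟ᵇ true) →-dec (adj G (g u) (g w) ≟ᵇ true))) ×-dec
    (any? λ i → all? λ u → all? λ w → (adj H u w ≟ᵇ true) →-dec (col c (g u) (g w) ≟ᶠ i))

  IsMonoCopy-resp : ∀ {g h} → (∀ x → g x ≡ h x) → IsMonoCopy g → IsMonoCopy h
  IsMonoCopy-resp {g} {h} g≗h ((injective , homomorphic) , i , mono) =
    ( (λ x y eq → injective x y (trans (g≗h x) (trans eq (sym (g≗h y)))))
    , (λ u w uw → subst₂ (λ a b → adj G a b ≡ true) (g≗h u) (g≗h w) (homomorphic u w uw)) )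
    , i , λ u w uw → trans (cong₂ (col c) (sym (g≗h u)) (sym (g≗h w))) (mono u w uw)

  MonoCopy? : Dec (MonoCopy H G c)
  MonoCopy? = map′
    (λ (g , (injective , homomorphic) , mono) →
       record { f = g ; inj = injective _ _ ; hom = homomorphic } , mono)
    (λ (e , mono) → f e , ((λ _ _ → inj e) , hom e) , mono)
    (any-function? (n H) IsMonoCopy IsMonoCopy-resp IsMonoCopy?)

MonoCopy-stable : ∀ {q} {H G : Graph} {c : Colouring q G} → ¬ ¬ MonoCopy H G c → MonoCopy H G c
MonoCopy-stable {H = H} {G} {c} ¬¬copy with MonoCopy? H G c
... | yes copy   = copy
... | no  ¬copy  = ⊥-elim (¬¬copy ¬copy)

unpair : ∀ m → Fin (m * m) → Fin m × Fin m
unpair m = remQuot {m} m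

combine-unpair : ∀ m (k : Fin (m * m)) → combine (proj₁ (unpair m k)) (proj₂ (unpair m k)) ≡ k
combine-unpair m k = combine-remQuot {m} m k

isEdge : (G : Graph) → Fin (n G * n G) → Bool
isEdge G k = adj G (proj₁ (unpair (n G) k)) (proj₂ (unpair (n G) k))

edges : Graph → ℕ
edges G = count (isEdge G)

size : Graph → ℕ
size G = n G + edges G

isEdge-combine : (G : Graph) (x y : Fin (n G)) → isEdge G (combine x y) ≡ adj G x y
isEdge-combine G x y = cong (λ (a , b) → adj G a b) (remQuot-combine x y)

module _ {G′ G : Graph} (e : Embedding G′ G) where

  pairMap : Fin (n G′ * n G′) → Fin (n G * n G)
  pairMap k = combine (f e (proj₁ (unpair (n G′) k))) (f e (proj₂ (unpair (n G′) k)))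

  pairMap-edge : ∀ k → isEdge G′ k ≡ true → isEdge G (pairMap k) ≡ true
  pairMap-edge k k∈E = trans (isEdge-combine G _ _) (hom e _ _ k∈E)

  pairMap-injective : ∀ k l → pairMap k ≡ pairMap l → k ≡ l
  pairMap-injective k l eq with combine-injective (f e (proj₁ (unpair (n G′) k))) _ _ _ eq
  ... | eq₁ , eq₂ = trans (sym (combine-unpair (n G′) k))
    (trans (cong₂ combine (inj e eq₁) (inj e eq₂)) (combine-unpair (n G′) l))

  vertices-mono : n G′ ≤ n G
  vertices-mono = subst₂ _≤_ (count-true (n G′)) (count-true (n G))
    (count-mono (λ _ → true) (λ _ → true) (λ x _ → f e x) (λ _ _ → refl) (λ _ _ → inj e))

  edges-mono : edges G′ ≤ edges G
  edges-mono = count-mono _ _ (λ k _ → pairMap k) pairMap-edge (λ _ _ → pairMap-injective _ _)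

  vertices-mono-< : ∀ w → (∀ x → f e x ≢ w) → n G′ < n G
  vertices-mono-< w missed = subst₂ _<_ (count-true (n G′)) (count-true (n G))
    (count-mono-< (λ _ → true) (λ _ → true) (λ x _ → f e x) (λ _ _ → refl) (λ _ _ → inj e)
      w refl (λ x _ → missed x))

  edges-mono-< : ∀ x y → adj G (f e x) (f e y) ≡ true → adj G′ x y ≡ false → edges G′ < edges G
  edges-mono-< x y xy∈G xy∉G′ =
    count-mono-< _ _ (λ k _ → pairMap k) pairMap-edge (λ _ _ → pairMap-injective _ _)
      (combine (f e x) (f e y)) (trans (isEdge-combine G _ _) xy∈G) missed
    where
    missed : ∀ k → isEdge G′ k ≡ true → pairMap k ≢ combine (f e x) (f e y)
    missed k k∈E eq with combine-injective _ _ _ _ eq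
    ... | eq₁ , eq₂ = case trans (sym k∈E) (trans (cong₂ (adj G′) (inj e eq₁) (inj e eq₂)) xy∉G′) of λ ()

proper⇒size< : ∀ {G′ G} → ProperSubgraph G′ G → size G′ < size G
proper⇒size< (e , inj₁ (w , missed)) =
  +-mono-<-≤ (vertices-mono-< e w missed) (edges-mono e)
proper⇒size< (e , inj₂ (x , y , xy∈G , xy∉G′)) =
  +-mono-≤-< (vertices-mono e) (edges-mono-< e x y xy∈G xy∉G′)

MinimalRamseySubgraph : ℕ → Graph → Graph → Set
MinimalRamseySubgraph q G H = Σ Graph λ G* → Embedding G* G × IsMinimalRamsey q G* H

minimalRamseySubgraph : ∀ q {G H} → IsRamsey q G H → ¬ ¬ MinimalRamseySubgraph q G H
minimalRamseySubgraph q {G} {H} ramsey = descend G ramsey (<-wellFounded (size G))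
  where
  descend : ∀ G → IsRamsey q G H → Acc _<_ (size G) → ¬ ¬ MinimalRamseySubgraph q G H
  descend G ramsey (acc smaller) none = none (G , idᴱ G , ramsey , λ G′ proper ramsey′ →
    descend G′ ramsey′ (smaller (proper⇒size< proper)) λ (G* , e , minimal) →
      none (G* , proj₁ proper ∘ᴱ e , minimal))

ramsey-vertex : ∀ {k G H} → IsRamsey (suc k) G H → Fin (n H) → Fin (n G)
ramsey-vertex ramsey = f (proj₁ (ramsey record { col = λ _ _ → zero ; colSym = λ _ _ → refl }))

-- Colouring the edges at a vertex v of degree ≤ qd by rank mod q leaves at most d edges at v
-- in each colour, so a monochromatic copy of H cannot pass through v.
δ-minimalRamsey-≥ : ∀ p d {G H} → suc d ≤ δ H → IsMinimalRamsey (suc p) G H → suc p * d + 1 ≤ δ G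
δ-minimalRamsey-≥ p d {G} {H} d<δH (ramsey , minimal) with suc p * d + 1 ≤? δ G
... | yes bound = bound
... | no ¬bound = ⊥-elim (minimal (G ─ v) (─-proper G v) ramsey─v)
  where
  q : ℕ
  q = suc p
  v : Fin (n G)
  v = proj₁ (δ-attained G (ramsey-vertex ramsey (vertex-of-δ>0 H (≤-trans (s≤s z≤n) d<δH))))
  degv≤ : count (adj G v) ≤ q * d
  degv≤ = begin
    count (adj G v) ≡⟨ deg≡count G v ⟨
    deg G v         ≡⟨ proj₂ (δ-attained G _) ⟨
    δ G             ≤⟨ ≤-pred (subst (δ G <_) (+-comm (q * d) 1) (≰⇒> ¬bound)) ⟩
    q * d           ∎
    where open ≤-Reasoning
  σ : Fin (n G) → Fin q
  σ w = rank (adj G v) w mod q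
  ramsey─v : IsRamsey q (G ─ v) H
  ramsey─v c with ramsey (extend G v c σ)
  ... | e , i , mono with any? (λ u → f e u ≟ᶠ v)
  ... | no avoids = restrict G v e (λ u u↦v → avoids (u , u↦v)) , i ,
    λ a b ab → trans (extend-restrict G v c σ e _ a b) (mono a b ab)
  ... | yes (u , u↦v) = ⊥-elim (<-irrefl refl (begin-strict
    d                                        <⟨ d<δH ⟩
    δ H                                      ≤⟨ δ≤deg H u ⟩
    deg H u                                  ≤⟨ deg≤count-neighbours e u↦v _ coloured-i ⟩
    count (λ w → adj G v w ∧ does (σ w ≟ᶠ i)) ≤⟨ count-rank-mod (adj G v) q d degv≤ i ⟩
    d                                        ∎))
    where
    open ≤-Reasoning
    coloured-i : ∀ w → adj H u w ≡ true → does (σ (f e w) ≟ᶠ i) ≡ true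
    coloured-i w uw = dec-true (σ (f e w) ≟ᶠ i) (trans (sym (extend-at G v c σ (f e w)))
      (trans (cong (λ x → col (extend G v c σ) x (f e w)) (sym u↦v)) (mono u w uw)))

MonoCopyIn : ∀ {q} (H G : Graph) → Colouring q G → Fin q → Set
MonoCopyIn H G c i = Σ (Embedding H G) λ e → ∀ a b → adj H a b ≡ true → col c (f e a) (f e b) ≡ i

nonzero : ∀ {k} → Fin k → Bool
nonzero zero    = false
nonzero (suc _) = true

dropZero : ∀ {k} (G : Graph) → Colouring (suc k) G → Graph
dropZero G χ = record
  { n      = n G
  ; adj    = λ x y → adj G x y ∧ nonzero (col χ x y)
  ; sym    = λ x y → cong₂ _∧_ (Graph.sym G x y) (cong nonzero (colSym χ x y))
  ; irrefl = λ x → cong (_∧ nonzero (col χ x x)) (irrefl G x)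
  }

dropZero-embedding : ∀ {k} (G : Graph) (χ : Colouring (suc k) G) → Embedding (dropZero G χ) G
dropZero-embedding G χ = record
  { f   = λ x → x
  ; inj = λ eq → eq
  ; hom = λ x y xy → proj₁ (∧-true⁻ xy)
  }

zeroOr : ∀ {k} → Fin (suc k) → Fin k → Fin (suc k)
zeroOr zero    _ = zero
zeroOr (suc _) j = suc j

zeroOr-zero : ∀ {k} {a : Fin (suc k)} {j} → zeroOr a j ≡ zero → a ≡ zero
zeroOr-zero {a = zero} _ = refl

zeroOr-suc : ∀ {k} {a : Fin (suc k)} {j i} → zeroOr a j ≡ suc i → nonzero a ≡ true × j ≡ i
zeroOr-suc {a = suc _} refl = refl , refl

overlay : ∀ {k} {G : Graph} (χ : Colouring (suc k) G) → Colouring k (dropZero G χ) → Colouring (suc k) G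
overlay χ c = record
  { col    = λ x y → zeroOr (col χ x y) (col c x y)
  ; colSym = λ x y → cong₂ zeroOr (colSym χ x y) (colSym c x y)
  }

dropZero-ramsey : ∀ {k} {G H : Graph} (χ : Colouring (suc k) G) → IsRamsey (suc k) G H →
  ¬ MonoCopyIn H G χ zero → IsRamsey k (dropZero G χ) H
dropZero-ramsey {G = G} {H} χ ramsey noZeroCopy c with ramsey (overlay χ c)
... | e , zero  , mono = ⊥-elim (noZeroCopy (e , λ a b ab → zeroOr-zero (mono a b ab)))
... | e , suc i , mono = e″ , i , λ a b ab → proj₂ (zeroOr-suc (mono a b ab))
  where
  e″ : Embedding H (dropZero G χ)
  e″ = record
    { f   = f e
    ; inj = inj e
    ; hom = λ a b ab → cong₂ _∧_ (hom e a b ab) (proj₁ (zeroOr-suc (mono a b ab)))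
    }

unshift : ∀ {k} → Fin (suc (suc k)) → Fin (suc k)
unshift zero    = zero  -- junk value: unshift is only applied to nonzero colours
unshift (suc j) = j

unshift-nonzero : ∀ {k} {a : Fin (suc (suc k))} → nonzero a ≡ true → a ≡ suc (unshift a)
unshift-nonzero {a = suc _} _ = refl

module ColourReduction {p d : ℕ} {H G : Graph} (δH≡ : δ H ≡ suc d) (v : Fin (n G))
  (c : Colouring (suc (suc p)) (G ─ v)) (noCopy : ¬ MonoCopy H (G ─ v) c) where

  aboveThreshold : Fin (n G) → Bool
  aboveThreshold w = does (d ≤? rank (adj G v) w)

  σ : Fin (n G) → Fin (suc (suc p))
  σ w = if aboveThreshold w then suc zero else zero

  ĉ : Colouring (suc (suc p)) G
  ĉ = extend G v c σ

  G″ : Graph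
  G″ = dropZero G ĉ

  nonzero-at : ∀ w → nonzero (col ĉ v w) ≡ aboveThreshold w
  nonzero-at w = trans (cong nonzero (extend-at G v c σ w)) (nonzero-σ (aboveThreshold w))
    where
    nonzero-σ : ∀ b → nonzero {suc (suc p)} (if b then suc zero else zero) ≡ b
    nonzero-σ true  = refl
    nonzero-σ false = refl

  noZeroCopy : ¬ MonoCopyIn H G ĉ zero
  noZeroCopy (e , mono) with any? (λ u → f e u ≟ᶠ v)
  ... | no avoids = noCopy (restrict G v e avoids′ , zero ,
    λ a b ab → trans (extend-restrict G v c σ e avoids′ a b) (mono a b ab))
    where
    avoids′ : ∀ u → f e u ≢ v
    avoids′ u u↦v = avoids (u , u↦v)
  ... | yes (u , u↦v) = <-irrefl refl (begin-strict
    d                                                    <⟨ ≤-reflexive (sym δH≡) ⟩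
    δ H                                                  ≤⟨ δ≤deg H u ⟩
    deg H u                                              ≤⟨ deg≤count-neighbours e u↦v _ belowThreshold ⟩
    count (λ w → adj G v w ∧ does (rank (adj G v) w <? d)) ≤⟨ count-rank-< (adj G v) d ⟩
    d                                                    ∎)
    where
    open ≤-Reasoning
    belowThreshold : ∀ w → adj H u w ≡ true → does (rank (adj G v) (f e w) <? d) ≡ true
    belowThreshold w uw = dec-true (_ <? d) (≰⇒> (does-false (d ≤? _) notAbove))
      where
      notAbove : aboveThreshold (f e w) ≡ false
      notAbove = trans (sym (nonzero-at (f e w)))
        (cong nonzero (trans (cong (λ x → col ĉ x (f e w)) (sym u↦v)) (mono u w uw)))

  G″-ramsey : IsRamsey (suc (suc p)) G H → IsRamsey (suc p) G″ H
  G″-ramsey ramsey = dropZero-ramsey ĉ ramsey noZeroCopy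

  ramseySubgraph-∋v : ∀ {G*} (e : Embedding G* G″) → IsRamsey (suc p) G* H → ∃[ x ] f e x ≡ v
  ramseySubgraph-∋v {G*} e ramsey* with any? (λ x → f e x ≟ᶠ v)
  ... | yes found = found
  ... | no avoids = ⊥-elim (noCopy (transfer (ramsey* pulledBack)))
    where
    e₀ : Embedding G* G
    e₀ = dropZero-embedding G ĉ ∘ᴱ e
    avoids′ : ∀ x → f e₀ x ≢ v
    avoids′ x x↦v = avoids (x , x↦v)
    e′ : Embedding G* (G ─ v)
    e′ = restrict G v e₀ avoids′
    pulledBack : Colouring (suc p) G*
    pulledBack = record
      { col    = λ x y → unshift (col c (f e′ x) (f e′ y))
      ; colSym = λ x y → cong unshift (colSym c _ _)
      }
    shifted : ∀ x y → adj G* x y ≡ true →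
      col c (f e′ x) (f e′ y) ≡ suc (unshift (col c (f e′ x) (f e′ y)))
    shifted x y xy = unshift-nonzero (trans (cong nonzero (extend-restrict G v c σ e₀ avoids′ x y))
      (proj₂ (∧-true⁻ {adj G (f e x) (f e y)} (hom e x y xy))))
    transfer : MonoCopy H G* pulledBack → MonoCopy H (G ─ v) c
    transfer (h , i , mono) = e′ ∘ᴱ h , suc i ,
      λ a b ab → trans (shifted _ _ (hom h a b ab)) (cong suc (mono a b ab))

  δ-ramseySubgraph-≤ : deg G v ≡ suc (suc p) * d + 1 →
    ∀ {G*} → Embedding G* G″ → IsRamsey (suc p) G* H → δ G* ≤ suc p * d + 1
  δ-ramseySubgraph-≤ degv {G*} e ramsey* with ramseySubgraph-∋v e ramsey*
  ... | x , x↦v = begin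
    δ G*                                       ≤⟨ δ≤deg G* x ⟩
    deg G* x                                   ≤⟨ deg≤count-neighbours (dropZero-embedding G ĉ ∘ᴱ e) x↦v _ above ⟩
    count (λ w → adj G v w ∧ aboveThreshold w) ≤⟨ count-rank-≥ (adj G v) d ⟩
    count (adj G v) ∸ d                        ≡⟨ cong (_∸ d) (trans (sym (deg≡count G v)) degv) ⟩
    (d + suc p * d) + 1 ∸ d                    ≡⟨ cong (_∸ d) (+-assoc d (suc p * d) 1) ⟩
    d + (suc p * d + 1) ∸ d                    ≡⟨ m+n∸m≡n d (suc p * d + 1) ⟩
    suc p * d + 1                              ∎
    where
    open ≤-Reasoning
    above : ∀ w → adj G* x w ≡ true → aboveThreshold (f e w) ≡ true
    above w xw = trans (sym (nonzero-at (f e w)))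
      (subst (λ y → nonzero (col ĉ y (f e w)) ≡ true) x↦v (proj₂ (∧-true⁻ (hom e x w xw))))

sq-step : ∀ p d {H} → δ H ≡ suc d →
  SqIs (suc (suc p)) H (suc (suc p) * d + 1) → ¬ ¬ SqIs (suc p) H (suc p * d + 1)
sq-step p d {H} δH≡ ((G , (ramsey , minimal) , δG≡) , _) ¬sq =
  minimal (G ─ v) (─-proper G v) λ c → MonoCopy-stable {c = c} λ noCopy →
    let open ColourReduction {p} {d} {H} {G} δH≡ v c noCopy in
    minimalRamseySubgraph (suc p) (G″-ramsey ramsey) λ (G* , e , minimal*) →
      ¬sq ((G* , minimal* , ≤-antisym (δ-ramseySubgraph-≤ degv e (proj₁ minimal*)) (lower minimal*)) ,
           λ _ → lower)
  where
  lower : ∀ {G*} → IsMinimalRamsey (suc p) G* H → suc p * d + 1 ≤ δ G*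
  lower = δ-minimalRamsey-≥ p d (≤-reflexive (sym δH≡))
  v : Fin (n G)
  v = proj₁ (δ-attained G (ramsey-vertex ramsey (vertex-of-δ>0 H (subst (0 <_) (sym δH≡) (s≤s z≤n)))))
  degv : deg G v ≡ suc (suc p) * d + 1
  degv = trans (sym (proj₂ (δ-attained G _))) δG≡

minimalRamsey-vertexless : ∀ {q} (G : Graph) {H} → ¬ Fin (n H) → IsMinimalRamsey (suc q) G H → δ G ≡ 0
minimalRamsey-vertexless record { n = zero } _ _ = refl
minimalRamsey-vertexless G@record { n = suc _ } {H} noVertex (_ , minimal) =
  ⊥-elim (minimal (G ─ zero) (─-proper G zero) λ _ → emptyCopy , zero , λ a → ⊥-elim (noVertex a))
  where
  emptyCopy : Embedding H (G ─ zero)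
  emptyCopy = record
    { f   = λ a → ⊥-elim (noVertex a)
    ; inj = λ {a} → ⊥-elim (noVertex a)
    ; hom = λ a → ⊥-elim (noVertex a)
    }

lemma2p1 : (q : ℕ) → 1 ≤ q → (H : Graph) →
    ¬ RamseySimple q H → ¬ RamseySimple (suc q) H
lemma2p1 (suc p) _ H ¬simple (H′ , deletion@(_ , _ , _ , _ , noIsolated) , simple@((G , minimal , δG≡) , _))
  with vertex? H′
... | inj₁ u        = sq-step p (δ H′ ∸ 1) (δ-noIsolated H′ noIsolated u) simple
                        λ simple′ → ¬simple (H′ , deletion , simple′)
... | inj₂ noVertex = 0≢1+n (begin
  0                            ≡⟨ minimalRamsey-vertexless G noVertex minimal ⟨
  δ G                          ≡⟨ δG≡ ⟩
  suc (suc p) * (δ H′ ∸ 1) + 1 ≡⟨ +-comm _ 1 ⟩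
  suc (suc (suc p) * (δ H′ ∸ 1)) ∎)
  where open ≡-Reasoning
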